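{- Let $F$ be a Boolean function and consider the problem $\mathrm{Holant}(\neq_2\mid\{F\})$. Assume every function of a gadget with two dangling edges in this problem has the form $\lambda\cdot(\neq_2)$ for some $\lambda\in\mathbb{C}$, and every function of a gadget with four dangling edges has the form $\lambda\,\neq_2(x_{\tau(1)},x_{\tau(2)})\neq_2(x_{\tau(3)},x_{\tau(4)})$ for some $\lambda\in\mathbb{C}$ and permutation $\tau$ of $\{1,2,3,4\}$. Then for every positive integer $n$, the values of all input networks with exactly $n$ vertices labeled $F$ are either all zero or all nonzero.
   Context: $\neq_2$ is the binary function with $\neq_2(0,1)=\neq_2(1,0)=1$ and $\neq_2(0,0)=\neq_2(1,1)=0$. An input network of $\mathrm{Holant}(\neq_2\mid\{F\})$ consists of vertices labeled $F$ (with ordered edge-ends) joined by edges, each edge carrying the function $\neq_2$ (equivalently, a bipartite network with $F$-vertices on one side and degree-2 vertices labeled $\neq_2$ on the other); its value is $\sum$ over all $\{0,1\}$-assignments to the edge-ends of the product of all $F$-values and all $\neq_2$-values. A gadget is such a network in which some edge-ends of $F$-vertices are left dangling; its function is the corresponding sum as a function of the dangling variables. -}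

module Defs where

open import Level using (Level)
open import Algebra.Bundles using (CommutativeRing)
open import Data.Nat using (ℕ; zero; suc; _<ᵇ_; _≡ᵇ_)
open import Data.Bool using (Bool; true; false; not; _xor_; _∧_; _∨_; if_then_else_)
open import Data.Fin using (Fin; toℕ)
open import Data.Fin.Permutation using (Permutation′; _⟨$⟩ʳ_)
open import Data.Product using (_×_; _,_; proj₁; proj₂; ∃-syntax)
open import Data.Vec.Functional using (_∷_)
open import Function.Definitions using (Injective)
open import Relation.Binary.PropositionalEquality using (_≡_)
open import Relation.Nullary using (¬_)

-- An edge-end of a vertex: (vertex index, position among its ordered edge-ends)
End : ℕ → ℕ → Set
End n k = Fin n × Fin k

-- Strict lexicographic order on edge-ends (used to count every edge once)
lexLess : ∀ {n k} → End n k → End n k → Bool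
lexLess (v , i) (w , j) =
  (toℕ v <ᵇ toℕ w) ∨ ((toℕ v ≡ᵇ toℕ w) ∧ (toℕ i <ᵇ toℕ j))

-- A gadget with n vertices labelled by an arity-k function F and m dangling
-- edge-ends.  `match` pairs up edge-ends joined by an edge (an involution);
-- its fixed points are exactly the dangling edge-ends, listed (injectively,
-- in order) by `dangle`.
record Gadget (n k m : ℕ) : Set where
  field
    match      : End n k → End n k
    dangle     : Fin m → End n k
    dangle-inj : Injective _≡_ _≡_ dangle
    involutive : ∀ e → match (match e) ≡ e
    fixed⇒dangling : ∀ e → match e ≡ e → ∃[ j ] dangle j ≡ e
    dangling⇒fixed : ∀ j → match (dangle j) ≡ dangle j

Network : ℕ → ℕ → Set
Network n k = Gadget n k 0

module _ {c ℓ} (R : CommutativeRing c ℓ) where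
  open CommutativeRing R renaming (Carrier to C)

  BoolFun : ℕ → Set c
  BoolFun k = (Fin k → Bool) → C

  natC : ℕ → C
  natC zero = 0#
  natC (suc n) = 1# + natC n

  record IsCharZeroField : Set (c Level.⊔ ℓ) where
    field
      inverse  : ∀ x → ¬ (x ≈ 0#) → ∃[ y ] (x * y ≈ 1#)
      charZero : ∀ n → natC n ≈ 0# → n ≡ 0

  bigProd : (n : ℕ) → (Fin n → C) → C
  bigProd zero f = 1#
  bigProd (suc n) f = f Fin.zero * bigProd n (λ i → f (Fin.suc i))

  sumBool : (Bool → C) → C
  sumBool f = f false + f true

  sumFn : {X : Set} → ((X → C) → C) → (n : ℕ) → ((Fin n → X) → C) → C
  sumFn S zero f = f (λ ())
  sumFn S (suc n) f = S (λ x → sumFn S n (λ a → f (x ∷ a)))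

  sumAssign : (n k : ℕ) → ((Fin n → Fin k → Bool) → C) → C
  sumAssign n k = sumFn (sumFn sumBool k) n

  neq2 : Bool → Bool → C
  neq2 x y = if x xor y then 1# else 0#

  eqInd : Bool → Bool → C
  eqInd x y = if x xor y then 0# else 1#

  gadgetFun : ∀ {n k m} → BoolFun k → Gadget n k m → (Fin m → Bool) → C
  gadgetFun {n} {k} {m} F G x = sumAssign n k λ a →
      bigProd m (λ j → eqInd (a (proj₁ (dangle j)) (proj₂ (dangle j))) (x j))
    * bigProd n (λ v → F (a v))
    * bigProd n (λ v → bigProd k (λ i →
        if lexLess (v , i) (match (v , i))
        then neq2 (a v i) (a (proj₁ (match (v , i))) (proj₂ (match (v , i))))
        else 1#))
    where open Gadget G

  value : ∀ {n k} → BoolFun k → Network n k → C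
  value F G = gadgetFun F G (λ ())

  Arity2Cond : ∀ {k} → BoolFun k → Set (c Level.⊔ ℓ)
  Arity2Cond {k} F = ∀ n (G : Gadget n k 2) → ∃[ λ′ ] ∀ x →
    gadgetFun F G x ≈ λ′ * neq2 (x Fin.zero) (x (Fin.suc Fin.zero))

  Arity4Cond : ∀ {k} → BoolFun k → Set (c Level.⊔ ℓ)
  Arity4Cond {k} F = ∀ n (G : Gadget n k 4) → ∃[ λ′ ] ∃[ τ ] ∀ x →
    gadgetFun F G x ≈ λ′ * (neq2 (x (τ ⟨$⟩ʳ f0)) (x (τ ⟨$⟩ʳ f1))
                          * neq2 (x (τ ⟨$⟩ʳ f2)) (x (τ ⟨$⟩ʳ f3)))
    where
      f0 f1 f2 f3 : Fin 4
      f0 = Fin.zero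
      f1 = Fin.suc Fin.zero
      f2 = Fin.suc (Fin.suc Fin.zero)
      f3 = Fin.suc (Fin.suc (Fin.suc Fin.zero))

-- Removing two edges {a, b} and {c, d} of a network G leaves a gadget K with four dangling
-- ends, and both G and the network G′ obtained by rejoining those ends as {a, c}, {b, d} are
-- closures of K: their values are Σₓ K(x)·≠₂(x₁,x₂)·≠₂(x₃,x₄) and Σₓ K(x)·≠₂(x₁,x₃)·≠₂(x₂,x₄).
-- By hypothesis K = λ·≠₂(x_τ1,x_τ2)·≠₂(x_τ3,x_τ4), so each value is λ times the number of
-- assignments satisfying both pairings. For G that number is positive whatever τ is, so in
-- characteristic zero value G = 0 forces λ = 0, hence value G′ = 0. Choosing a where G and H
-- are wired differently and c = H(a), G′ agrees with H at a and wherever G did, so finitely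
-- many such rewirings carry G to H while keeping the value zero.

module Submission where

open import Defs
open import Level using (_⊔_) renaming (zero to lzero; suc to lsuc)
open import Algebra.Bundles using (CommutativeRing)
open import Algebra.Definitions using (Involutive)
open import Data.Bool using (Bool; true; false; if_then_else_; _∧_; _∨_; not; _xor_)
open import Data.Empty using (⊥-elim)
open import Data.Fin as Fin using (Fin; toℕ; _≟_)
open import Data.Fin.Patterns using (0F; 1F; 2F; 3F)
open import Data.Fin.Permutation using (_⟨$⟩ʳ_)
open import Data.Fin.Properties using (all?; any?; toℕ-injective; suc-injective)
open import Data.Nat as Nat using (ℕ; zero; suc; _<ᵇ_; _≡ᵇ_; _≤_; _<_; _≥_; z≤n; s≤s)
open import Data.Nat.Induction using (<-wellFounded)
open import Data.Nat.Properties using (+-0-monoid; +-mono-≤; +-mono-<-≤; +-mono-≤-<)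
open import Algebra.Properties.Monoid.Sum +-0-monoid using (sum)
open import Data.Product using (_×_; _,_; proj₁; proj₂; ∃-syntax)
open import Data.Product.Properties using (≡-dec)
open import Data.Sum using (_⊎_; inj₁; inj₂)
open import Data.Vec.Functional using (_∷_; []; head; tail)
open import Data.Vec.Functional.Properties using (∷-cong)
open import Function using (_∘_; Injective)
open import Function.Bundles using (Injection)
open import Function.Properties.Inverse using (↔⇒↣)
open import Induction.WellFounded using (WellFounded; Acc; acc)
open import Relation.Binary.Definitions using (DecidableEquality)
import Relation.Binary.Construct.On as On
open import Relation.Binary.PropositionalEquality as ≡ using (_≡_; _≢_; _≗_)
open import Relation.Nullary using (¬_)
open import Relation.Nullary.Decidable using (Dec; yes; no; from-yes; ¬?; _→-dec_)

count : ∀ m → ((Fin m → Bool) → Bool) → ℕ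
count zero    B = if B (λ ()) then 1 else 0
count (suc m) B = count m (λ x → B (false ∷ x)) Nat.+ count m (λ x → B (true ∷ x))

separates : (Fin 4 → Bool) → Fin 4 → Fin 4 → Fin 4 → Fin 4 → Bool
separates x u₀ u₁ u₂ u₃ = (x u₀ xor x u₁) ∧ (x u₂ xor x u₃)

-- The union of two pairings of four points is a union of even cycles, hence 2-colourable.
count-common-separators≢0 : ∀ u₀ u₁ u₂ u₃ →
  u₀ ≢ u₁ → u₀ ≢ u₂ → u₀ ≢ u₃ → u₁ ≢ u₂ → u₁ ≢ u₃ → u₂ ≢ u₃ →
  count 4 (λ x → separates x u₀ u₁ u₂ u₃ ∧ separates x 0F 1F 2F 3F) ≢ 0
count-common-separators≢0 = from-yes
  (all? λ u₀ → all? λ u₁ → all? λ u₂ → all? λ u₃ →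
     ¬? (u₀ ≟ u₁) →-dec ¬? (u₀ ≟ u₂) →-dec ¬? (u₀ ≟ u₃) →-dec
     ¬? (u₁ ≟ u₂) →-dec ¬? (u₁ ≟ u₃) →-dec ¬? (u₂ ≟ u₃) →-dec
     ¬? (count 4 (λ x → separates x u₀ u₁ u₂ u₃ ∧ separates x 0F 1F 2F 3F) Nat.≟ 0))

module Matchings {E : Set} (_≟ᴱ_ : DecidableEquality E) where
  open ≡.≡-Reasoning

  cutEdge : E → (E → E) → E → E
  cutEdge p M e with e ≟ᴱ p | e ≟ᴱ M p
  ... | no _ | no _ = M e
  ... | _    | _    = e

  join : E → E → (E → E) → E → E
  join p q K e with e ≟ᴱ p | e ≟ᴱ q
  ... | yes _ | _     = q
  ... | no _  | yes _ = p
  ... | no _  | no _  = K e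

  module _ {p : E} {M : E → E} where

    cutEdge-fixes-p : cutEdge p M p ≡ p
    cutEdge-fixes-p with p ≟ᴱ p
    ... | yes _  = ≡.refl
    ... | no p≢p = ⊥-elim (p≢p ≡.refl)

    cutEdge-fixes-Mp : cutEdge p M (M p) ≡ M p
    cutEdge-fixes-Mp with M p ≟ᴱ p | M p ≟ᴱ M p
    ... | yes _ | _        = ≡.refl
    ... | no _  | yes _    = ≡.refl
    ... | no _  | no Mp≢Mp = ⊥-elim (Mp≢Mp ≡.refl)

    cutEdge-off : ∀ {e} → e ≢ p → e ≢ M p → cutEdge p M e ≡ M e
    cutEdge-off {e} e≢p e≢Mp with e ≟ᴱ p | e ≟ᴱ M p
    ... | yes e≡p | _        = ⊥-elim (e≢p e≡p)
    ... | no _    | yes e≡Mp = ⊥-elim (e≢Mp e≡Mp)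
    ... | no _    | no _     = ≡.refl

    cutEdge-involutive : Involutive _≡_ M → Involutive _≡_ (cutEdge p M)
    cutEdge-involutive M-inv e = by-cases (e ≟ᴱ p) (e ≟ᴱ M p)
      where
      by-cases : Dec (e ≡ p) → Dec (e ≡ M p) → cutEdge p M (cutEdge p M e) ≡ e
      by-cases (yes ≡.refl) _ = ≡.trans (≡.cong (cutEdge p M) cutEdge-fixes-p) cutEdge-fixes-p
      by-cases (no _) (yes ≡.refl) =
        ≡.trans (≡.cong (cutEdge p M) cutEdge-fixes-Mp) cutEdge-fixes-Mp
      by-cases (no e≢p) (no e≢Mp) = begin
        cutEdge p M (cutEdge p M e) ≡⟨ ≡.cong (cutEdge p M) (cutEdge-off e≢p e≢Mp) ⟩
        cutEdge p M (M e)           ≡⟨ cutEdge-off Me≢p Me≢Mp ⟩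
        M (M e)                     ≡⟨ M-inv e ⟩
        e                           ∎
        where
        Me≢p : M e ≢ p
        Me≢p Me≡p = e≢Mp (≡.trans (≡.sym (M-inv e)) (≡.cong M Me≡p))
        Me≢Mp : M e ≢ M p
        Me≢Mp Me≡Mp = e≢p (≡.trans (≡.sym (M-inv e)) (≡.trans (≡.cong M Me≡Mp) (M-inv p)))

    cutEdge-fixed : ∀ {e} → cutEdge p M e ≡ e → e ≡ p ⊎ e ≡ M p ⊎ M e ≡ e
    cutEdge-fixed {e} fixed with e ≟ᴱ p | e ≟ᴱ M p
    ... | yes e≡p | _        = inj₁ e≡p
    ... | no _    | yes e≡Mp = inj₂ (inj₁ e≡Mp)
    ... | no _    | no _     = inj₂ (inj₂ fixed)

  module _ {p q : E} {K : E → E} where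

    join-p : join p q K p ≡ q
    join-p with p ≟ᴱ p
    ... | yes _  = ≡.refl
    ... | no p≢p = ⊥-elim (p≢p ≡.refl)

    join-q : join p q K q ≡ p
    join-q with q ≟ᴱ p | q ≟ᴱ q
    ... | yes q≡p | _      = q≡p
    ... | no _    | yes _  = ≡.refl
    ... | no _    | no q≢q = ⊥-elim (q≢q ≡.refl)

    join-off : ∀ {e} → e ≢ p → e ≢ q → join p q K e ≡ K e
    join-off {e} e≢p e≢q with e ≟ᴱ p | e ≟ᴱ q
    ... | yes e≡p | _       = ⊥-elim (e≢p e≡p)
    ... | no _    | yes e≡q = ⊥-elim (e≢q e≡q)
    ... | no _    | no _    = ≡.refl

    join-involutive : Involutive _≡_ K → K p ≡ p → K q ≡ q → Involutive _≡_ (join p q K)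
    join-involutive K-inv Kp≡p Kq≡q e = by-cases (e ≟ᴱ p) (e ≟ᴱ q)
      where
      K-moves : ∀ {t} → e ≢ t → K t ≡ t → K e ≢ t
      K-moves e≢t Kt≡t Ke≡t = e≢t (≡.trans (≡.sym (K-inv e)) (≡.trans (≡.cong K Ke≡t) Kt≡t))
      by-cases : Dec (e ≡ p) → Dec (e ≡ q) → join p q K (join p q K e) ≡ e
      by-cases (yes ≡.refl) _ = ≡.trans (≡.cong (join p q K) join-p) join-q
      by-cases (no _) (yes ≡.refl) = ≡.trans (≡.cong (join p q K) join-q) join-p
      by-cases (no e≢p) (no e≢q) = begin
        join p q K (join p q K e) ≡⟨ ≡.cong (join p q K) (join-off e≢p e≢q) ⟩
        join p q K (K e)          ≡⟨ join-off (K-moves e≢p Kp≡p) (K-moves e≢q Kq≡q) ⟩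
        K (K e)                   ≡⟨ K-inv e ⟩
        e                         ∎

    join-fixed : p ≢ q → ∀ {e} → join p q K e ≡ e → e ≢ p × e ≢ q × K e ≡ e
    join-fixed p≢q {e} fixed with e ≟ᴱ p | e ≟ᴱ q
    ... | yes ≡.refl | _          = ⊥-elim (p≢q (≡.sym fixed))
    ... | no _       | yes ≡.refl = ⊥-elim (p≢q fixed)
    ... | no e≢p     | no e≢q     = e≢p , e≢q , fixed

<ᵇ-irrefl : ∀ m → (m <ᵇ m) ≡ false
<ᵇ-irrefl zero    = ≡.refl
<ᵇ-irrefl (suc m) = <ᵇ-irrefl m

≡ᵇ-refl : ∀ m → (m ≡ᵇ m) ≡ true
≡ᵇ-refl zero    = ≡.refl
≡ᵇ-refl (suc m) = ≡ᵇ-refl m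

<ᵇ-connex : ∀ m n → m ≢ n → (m <ᵇ n) ≡ not (n <ᵇ m)
<ᵇ-connex zero    zero    m≢n = ⊥-elim (m≢n ≡.refl)
<ᵇ-connex zero    (suc n) _   = ≡.refl
<ᵇ-connex (suc m) zero    _   = ≡.refl
<ᵇ-connex (suc m) (suc n) m≢n = <ᵇ-connex m n (m≢n ∘ ≡.cong suc)

lex-connex : ∀ m n i j → (m ≡ n → i ≢ j) →
  ((m <ᵇ n) ∨ ((m ≡ᵇ n) ∧ (i <ᵇ j))) ≡ not ((n <ᵇ m) ∨ ((n ≡ᵇ m) ∧ (j <ᵇ i)))
lex-connex zero    zero    i j ≢ = <ᵇ-connex i j (≢ ≡.refl)
lex-connex zero    (suc n) i j _ = ≡.refl
lex-connex (suc m) zero    i j _ = ≡.refl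
lex-connex (suc m) (suc n) i j ≢ = lex-connex m n i j (≢ ∘ ≡.cong suc)

module _ {n k : ℕ} where

  lexLess-irrefl : ∀ (u : End n k) → lexLess u u ≡ false
  lexLess-irrefl (v , i) rewrite <ᵇ-irrefl (toℕ v) | ≡ᵇ-refl (toℕ v) = <ᵇ-irrefl (toℕ i)

  lexLess-connex : ∀ {u w : End n k} → u ≢ w → lexLess u w ≡ not (lexLess w u)
  lexLess-connex {v , i} {v′ , i′} u≢w = lex-connex (toℕ v) (toℕ v′) (toℕ i) (toℕ i′)
    λ v≡v′ i≡i′ → u≢w (≡.cong₂ _,_ (toℕ-injective v≡v′) (toℕ-injective i≡i′))

  _≟ᴱ_ : DecidableEquality (End n k)
  _≟ᴱ_ = ≡-dec _≟_ _≟_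

module Sums {r ℓ} (R : CommutativeRing r ℓ) where
  open CommutativeRing R renaming (Carrier to C)
  open import Relation.Binary.Reasoning.Setoid setoid
  import Algebra.Properties.CommutativeSemigroup +-commutativeSemigroup as +-CS

  record IsLinear {X : Set} (S : (X → C) → C) : Set (r ⊔ ℓ) where
    field
      sum-cong : ∀ {f g} → (∀ x → f x ≈ g x) → S f ≈ S g
      sum-+    : ∀ f g → S (λ x → f x + g x) ≈ S f + S g
      sum-*ˡ   : ∀ a f → S (λ x → a * f x) ≈ a * S f

    sum-*ʳ : ∀ f a → S f * a ≈ S (λ x → f x * a)
    sum-*ʳ f a = begin
      S f * a             ≈⟨ *-comm _ _ ⟩
      a * S f             ≈⟨ sum-*ˡ a f ⟨
      S (λ x → a * f x)   ≈⟨ sum-cong (λ x → *-comm _ _) ⟩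
      S (λ x → f x * a)   ∎

  open IsLinear public

  CommutesWithLinear : {X : Set} → ((X → C) → C) → Set (lsuc lzero ⊔ r ⊔ ℓ)
  CommutesWithLinear {X} S = ∀ {Y : Set} (T : (Y → C) → C) → IsLinear T →
    ∀ (f : X → Y → C) → S (λ x → T (f x)) ≈ T (λ y → S (λ x → f x y))

  sumBool-linear : IsLinear (sumBool R)
  sumBool-linear = record
    { sum-cong = λ f≈g → +-cong (f≈g false) (f≈g true)
    ; sum-+    = λ f g → +-CS.interchange (f false) (g false) (f true) (g true)
    ; sum-*ˡ   = λ a f → sym (distribˡ a (f false) (f true))
    }

  sumBool-commutes : CommutesWithLinear (sumBool R)
  sumBool-commutes T T-lin f = sym (sum-+ T-lin (f false) (f true))

  sumFn-linear : {X : Set} {S : (X → C) → C} → IsLinear S → ∀ n → IsLinear (sumFn R S n)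
  sumFn-linear S-lin zero = record
    { sum-cong = λ f≈g → f≈g _ ; sum-+ = λ _ _ → refl ; sum-*ˡ = λ _ _ → refl }
  sumFn-linear S-lin (suc n) = record
    { sum-cong = λ f≈g → sum-cong S-lin (λ x → sum-cong IH (λ a → f≈g (x ∷ a)))
    ; sum-+    = λ f g → trans (sum-cong S-lin (λ x → sum-+ IH _ _)) (sum-+ S-lin _ _)
    ; sum-*ˡ   = λ a f → trans (sum-cong S-lin (λ x → sum-*ˡ IH a _)) (sum-*ˡ S-lin a _)
    }
    where IH = sumFn-linear S-lin n

  sumFn-commutes : {X : Set} {S : (X → C) → C} → IsLinear S → CommutesWithLinear S →
                   ∀ n → CommutesWithLinear (sumFn R S n)
  sumFn-commutes S-lin S-comm zero    T T-lin f = refl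
  sumFn-commutes S-lin S-comm (suc n) T T-lin f =
    trans (sum-cong S-lin (λ x → sumFn-commutes S-lin S-comm n T T-lin (λ a → f (x ∷ a))))
          (S-comm T T-lin _)

  sumBits : ∀ m → ((Fin m → Bool) → C) → C
  sumBits = sumFn R (sumBool R)

  sumBits-linear : ∀ m → IsLinear (sumBits m)
  sumBits-linear = sumFn-linear sumBool-linear

  sumBits-commutes : ∀ m → CommutesWithLinear (sumBits m)
  sumBits-commutes = sumFn-commutes sumBool-linear sumBool-commutes

  sumAssign-linear : ∀ n k → IsLinear (sumAssign R n k)
  sumAssign-linear n k = sumFn-linear (sumBits-linear k) n

  sumBool-eqInd : ∀ b (g : Bool → C) → sumBool R (λ b′ → eqInd R b b′ * g b′) ≈ g b
  sumBool-eqInd false g = trans (+-cong (*-identityˡ _) (zeroˡ _)) (+-identityʳ _)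
  sumBool-eqInd true  g = trans (+-cong (zeroˡ _) (*-identityˡ _)) (+-identityˡ _)

  sumBits-eqInd : ∀ m (y : Fin m → Bool) (P : (Fin m → Bool) → C) →
    (∀ {x x′} → x ≗ x′ → P x ≈ P x′) →
    sumBits m (λ x → bigProd R m (λ j → eqInd R (y j) (x j)) * P x) ≈ P y
  sumBits-eqInd zero    y P P-resp = trans (*-identityˡ _) (P-resp (λ ()))
  sumBits-eqInd (suc m) y P P-resp = begin
    sumBool R (λ b → sumBits m (λ x → (eqInd R (head y) b * δ x) * P (b ∷ x)))
      ≈⟨ sum-cong sumBool-linear {g = λ b → eqInd R (head y) b * P (b ∷ tail y)} collapse-tail ⟩
    sumBool R (λ b → eqInd R (head y) b * P (b ∷ tail y))
      ≈⟨ sumBool-eqInd (head y) (λ b → P (b ∷ tail y)) ⟩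
    P (head y ∷ tail y)
      ≈⟨ P-resp (∷-cong ≡.refl (λ _ → ≡.refl)) ⟩
    P y ∎
    where
    lin = sumBits-linear m
    δ : (Fin m → Bool) → C
    δ x = bigProd R m (λ j → eqInd R (tail y j) (x j))
    collapse-tail : ∀ b → sumBits m (λ x → (eqInd R (head y) b * δ x) * P (b ∷ x))
                           ≈ eqInd R (head y) b * P (b ∷ tail y)
    collapse-tail b = begin
      sumBits m (λ x → (eqInd R (head y) b * δ x) * P (b ∷ x))
        ≈⟨ sum-cong lin (λ x → *-assoc _ _ _) ⟩
      sumBits m (λ x → eqInd R (head y) b * (δ x * P (b ∷ x)))
        ≈⟨ sum-*ˡ lin _ _ ⟩
      eqInd R (head y) b * sumBits m (λ x → δ x * P (b ∷ x))
        ≈⟨ *-congˡ (sumBits-eqInd m (tail y) (λ x → P (b ∷ x)) (λ x≗x′ → P-resp (∷-cong ≡.refl x≗x′))) ⟩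
      eqInd R (head y) b * P (b ∷ tail y) ∎

  indicator : Bool → C
  indicator b = if b then 1# else 0#

  indicator-∧ : ∀ p q → indicator p * indicator q ≈ indicator (p ∧ q)
  indicator-∧ true  q = *-identityˡ _
  indicator-∧ false q = zeroˡ _

  natC-+ : ∀ a b → natC R (a Nat.+ b) ≈ natC R a + natC R b
  natC-+ zero    b = sym (+-identityˡ _)
  natC-+ (suc a) b = trans (+-congˡ (natC-+ a b)) (sym (+-assoc _ _ _))

  sumBits-indicator : ∀ m (B : (Fin m → Bool) → Bool) →
    sumBits m (λ x → indicator (B x)) ≈ natC R (count m B)
  sumBits-indicator zero B = indicator-natC (B (λ ()))
    where
    indicator-natC : ∀ b → indicator b ≈ natC R (if b then 1 else 0)
    indicator-natC true  = sym (+-identityʳ _)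
    indicator-natC false = refl
  sumBits-indicator (suc m) B = trans
    (+-cong (sumBits-indicator m (λ x → B (false ∷ x))) (sumBits-indicator m (λ x → B (true ∷ x))))
    (sym (natC-+ (count m (λ x → B (false ∷ x))) (count m (λ x → B (true ∷ x)))))

  pairing : Fin 4 → Fin 4 → Fin 4 → Fin 4 → (Fin 4 → Bool) → C
  pairing u₀ u₁ u₂ u₃ x = neq2 R (x u₀) (x u₁) * neq2 R (x u₂) (x u₃)

  pairing-indicator : ∀ u₀ u₁ u₂ u₃ x → pairing u₀ u₁ u₂ u₃ x ≈ indicator (separates x u₀ u₁ u₂ u₃)
  pairing-indicator u₀ u₁ u₂ u₃ x = indicator-∧ (x u₀ xor x u₁) (x u₂ xor x u₃)

  pairing-resp-≗ : ∀ u₀ u₁ u₂ u₃ {x x′} → x ≗ x′ → pairing u₀ u₁ u₂ u₃ x ≈ pairing u₀ u₁ u₂ u₃ x′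
  pairing-resp-≗ u₀ u₁ u₂ u₃ x≗x′ rewrite x≗x′ u₀ | x≗x′ u₁ | x≗x′ u₂ | x≗x′ u₃ = refl

  sumBits-scaled-indicators : ∀ m (g P : (Fin m → Bool) → C) λ′ (A B : (Fin m → Bool) → Bool) →
    (∀ x → g x ≈ λ′ * indicator (A x)) → (∀ x → P x ≈ indicator (B x)) →
    sumBits m (λ x → g x * P x) ≈ λ′ * natC R (count m (λ x → A x ∧ B x))
  sumBits-scaled-indicators m g P λ′ A B g≈ P≈ = begin
    sumBits m (λ x → g x * P x)                      ≈⟨ sum-cong lin pointwise ⟩
    sumBits m (λ x → λ′ * indicator (A x ∧ B x))     ≈⟨ sum-*ˡ lin λ′ _ ⟩
    λ′ * sumBits m (λ x → indicator (A x ∧ B x))     ≈⟨ *-congˡ (sumBits-indicator m (λ x → A x ∧ B x)) ⟩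
    λ′ * natC R (count m (λ x → A x ∧ B x))          ∎
    where
    lin = sumBits-linear m
    pointwise : ∀ x → g x * P x ≈ λ′ * indicator (A x ∧ B x)
    pointwise x = begin
      g x * P x                                ≈⟨ *-cong (g≈ x) (P≈ x) ⟩
      (λ′ * indicator (A x)) * indicator (B x) ≈⟨ *-assoc _ _ _ ⟩
      λ′ * (indicator (A x) * indicator (B x)) ≈⟨ *-congˡ (indicator-∧ (A x) (B x)) ⟩
      λ′ * indicator (A x ∧ B x)               ∎

module _ {r ℓ} {R : CommutativeRing r ℓ} (R-field : IsCharZeroField R) where
  open CommutativeRing R
  open IsCharZeroField R-field
  open import Relation.Binary.Reasoning.Setoid setoid

  *-natC-cancel : ∀ x m → m ≢ 0 → x * natC R m ≈ 0# → x ≈ 0#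
  *-natC-cancel x m m≢0 x*m≈0 with inverse (natC R m) (m≢0 ∘ charZero m)
  ... | m⁻¹ , m*m⁻¹≈1 = begin
    x                    ≈⟨ *-identityʳ x ⟨
    x * 1#               ≈⟨ *-congˡ m*m⁻¹≈1 ⟨
    x * (natC R m * m⁻¹) ≈⟨ *-assoc _ _ _ ⟨
    (x * natC R m) * m⁻¹ ≈⟨ *-congʳ x*m≈0 ⟩
    0# * m⁻¹             ≈⟨ zeroˡ m⁻¹ ⟩
    0#                   ∎

module Weights {r ℓ} (R : CommutativeRing r ℓ) where
  open CommutativeRing R renaming (Carrier to C)
  open import Relation.Binary.Reasoning.Setoid setoid

  bigProd-cong : ∀ m {f g : Fin m → C} → (∀ i → f i ≈ g i) → bigProd R m f ≈ bigProd R m g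
  bigProd-cong zero    f≈g = refl
  bigProd-cong (suc m) f≈g = *-cong (f≈g Fin.zero) (bigProd-cong m (f≈g ∘ Fin.suc))

  bigProd-update : ∀ m {f g : Fin m → C} (i₀ : Fin m) z → (∀ i → i ≢ i₀ → f i ≈ g i) →
    f i₀ ≈ g i₀ * z → bigProd R m f ≈ bigProd R m g * z
  bigProd-update (suc m) {f} {g} Fin.zero z f≈g f₀≈g₀z = begin
    f Fin.zero * bigProd R m (f ∘ Fin.suc)
      ≈⟨ *-cong f₀≈g₀z (bigProd-cong m (λ i → f≈g (Fin.suc i) (λ ()))) ⟩
    (g Fin.zero * z) * bigProd R m (g ∘ Fin.suc) ≈⟨ *-assoc _ _ _ ⟩
    g Fin.zero * (z * bigProd R m (g ∘ Fin.suc)) ≈⟨ *-congˡ (*-comm _ _) ⟩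
    g Fin.zero * (bigProd R m (g ∘ Fin.suc) * z) ≈⟨ *-assoc _ _ _ ⟨
    (g Fin.zero * bigProd R m (g ∘ Fin.suc)) * z ∎
  bigProd-update (suc m) {f} {g} (Fin.suc i₀) z f≈g fi₀≈gi₀z = begin
    f Fin.zero * bigProd R m (f ∘ Fin.suc)
      ≈⟨ *-cong (f≈g Fin.zero (λ ()))
           (bigProd-update m i₀ z (λ i i≢i₀ → f≈g (Fin.suc i) (i≢i₀ ∘ suc-injective)) fi₀≈gi₀z) ⟩
    g Fin.zero * (bigProd R m (g ∘ Fin.suc) * z) ≈⟨ *-assoc _ _ _ ⟨
    (g Fin.zero * bigProd R m (g ∘ Fin.suc)) * z ∎

  module _ {n k : ℕ} where

    prodEnds : (End n k → C) → C
    prodEnds f = bigProd R n (λ v → bigProd R k (λ i → f (v , i)))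

    prodEnds-cong : ∀ {f g : End n k → C} → (∀ e → f e ≈ g e) → prodEnds f ≈ prodEnds g
    prodEnds-cong f≈g = bigProd-cong n (λ v → bigProd-cong k (λ i → f≈g (v , i)))

    prodEnds-update : ∀ {f g : End n k → C} p → (∀ e → e ≢ p → f e ≈ g e) → g p ≈ 1# →
      prodEnds f ≈ prodEnds g * f p
    prodEnds-update {f} {g} (v₀ , i₀) f≈g gp≈1 =
      bigProd-update n v₀ (f (v₀ , i₀))
        (λ v v≢v₀ → bigProd-cong k (λ i → f≈g (v , i) (v≢v₀ ∘ ≡.cong proj₁)))
        (bigProd-update k i₀ (f (v₀ , i₀))
          (λ i i≢i₀ → f≈g (v₀ , i) (i≢i₀ ∘ ≡.cong proj₂))
          (trans (sym (*-identityˡ _)) (*-congʳ (sym gp≈1))))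

    prodEnds-update₂ : ∀ {f g : End n k → C} {p q} → p ≢ q →
      (∀ e → e ≢ p → e ≢ q → f e ≈ g e) → g p ≈ 1# → g q ≈ 1# →
      prodEnds f ≈ prodEnds g * (f p * f q)
    prodEnds-update₂ {f} {g} {p} {q} p≢q f≈g gp≈1 gq≈1 = begin
      prodEnds f                 ≈⟨ prodEnds-update p (λ e e≢p → reflexive (≡.sym (h-off e≢p))) h-p ⟩
      prodEnds h * f p           ≈⟨ *-congʳ (prodEnds-update q h≈g gq≈1) ⟩
      (prodEnds g * h q) * f p   ≈⟨ *-congʳ (*-congˡ (reflexive (h-off (p≢q ∘ ≡.sym)))) ⟩
      (prodEnds g * f q) * f p   ≈⟨ *-assoc _ _ _ ⟩
      prodEnds g * (f q * f p)   ≈⟨ *-congˡ (*-comm _ _) ⟩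
      prodEnds g * (f p * f q)   ∎
      where
      h : End n k → C
      h e with e ≟ᴱ p
      ... | yes _ = 1#
      ... | no _  = f e
      h-p : h p ≈ 1#
      h-p with p ≟ᴱ p
      ... | yes _  = refl
      ... | no p≢p = ⊥-elim (p≢p ≡.refl)
      h-off : ∀ {e} → e ≢ p → h e ≡ f e
      h-off {e} e≢p with e ≟ᴱ p
      ... | yes e≡p = ⊥-elim (e≢p e≡p)
      ... | no _    = ≡.refl
      h≈g : ∀ e → e ≢ q → h e ≈ g e
      h≈g e e≢q with e ≟ᴱ p
      ... | yes ≡.refl = sym gp≈1
      ... | no e≢p     = f≈g e e≢p e≢q

    Assignment : Set
    Assignment = Fin n → Fin k → Bool

    _at_ : Assignment → End n k → Bool
    α at e = α (proj₁ e) (proj₂ e)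

    link : Assignment → End n k → End n k → C
    link α u w = if lexLess u w then neq2 R (α at u) (α at w) else 1#

    -- Definitionally the ≠₂-factor of `gadgetFun`: each edge is charged once, at its
    -- lexicographically smaller end.
    weight : (End n k → End n k) → Assignment → C
    weight M α = prodEnds (λ e → link α e (M e))

    weight-cong : ∀ {M N} → (∀ e → M e ≡ N e) → ∀ α → weight M α ≈ weight N α
    weight-cong M≗N α = prodEnds-cong (λ e → reflexive (≡.cong (link α e) (M≗N e)))

    link-self : ∀ α {u t} → t ≡ u → link α u t ≈ 1#
    link-self α {u} ≡.refl rewrite lexLess-irrefl u = refl

    link-pair : ∀ α {u w} → u ≢ w → link α u w * link α w u ≈ neq2 R (α at u) (α at w)
    link-pair α {u} {w} u≢w rewrite lexLess-connex u≢w with lexLess w u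
    ... | false = *-identityʳ _
    ... | true  = trans (*-identityˡ _) (reflexive (neq2-comm (α at w) (α at u)))
      where
      neq2-comm : ∀ x y → neq2 R x y ≡ neq2 R y x
      neq2-comm false false = ≡.refl
      neq2-comm false true  = ≡.refl
      neq2-comm true  false = ≡.refl
      neq2-comm true  true  = ≡.refl

    weight-pair : ∀ {M N : End n k → End n k} {p q} α → p ≢ q →
      M p ≡ q → M q ≡ p → N p ≡ p → N q ≡ q → (∀ e → e ≢ p → e ≢ q → M e ≡ N e) →
      weight M α ≈ weight N α * neq2 R (α at p) (α at q)
    weight-pair {M} {N} {p} {q} α p≢q Mp≡q Mq≡p Np≡p Nq≡q M≡N = begin
      weight M α
        ≈⟨ prodEnds-update₂ {f = edge M} {g = edge N} p≢q
             (λ e e≢p e≢q → reflexive (≡.cong (link α e) (M≡N e e≢p e≢q)))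
             (link-self α Np≡p) (link-self α Nq≡q) ⟩
      weight N α * (link α p (M p) * link α q (M q))
        ≡⟨ ≡.cong₂ (λ s t → weight N α * (link α p s * link α q t)) Mp≡q Mq≡p ⟩
      weight N α * (link α p q * link α q p)
        ≈⟨ *-congˡ (link-pair α p≢q) ⟩
      weight N α * neq2 R (α at p) (α at q) ∎
      where
      edge : (End n k → End n k) → End n k → C
      edge L e = link α e (L e)

    open Matchings (_≟ᴱ_ {n} {k})

    weight-cutEdge : ∀ {M p} α → Involutive _≡_ M → p ≢ M p →
      weight M α ≈ weight (cutEdge p M) α * neq2 R (α at p) (α at M p)
    weight-cutEdge {M} {p} α M-inv p≢Mp =
      weight-pair {M} {cutEdge p M} α p≢Mp ≡.refl (M-inv p)
        (cutEdge-fixes-p {p} {M}) (cutEdge-fixes-Mp {p} {M})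
        (λ e e≢p e≢Mp → ≡.sym (cutEdge-off e≢p e≢Mp))

    weight-join : ∀ {K p q} α → p ≢ q → K p ≡ p → K q ≡ q →
      weight (join p q K) α ≈ weight K α * neq2 R (α at p) (α at q)
    weight-join {K} {p} {q} α p≢q Kp≡p Kq≡q =
      weight-pair {join p q K} {K} α p≢q (join-p {p} {q} {K}) (join-q {p} {q} {K}) Kp≡p Kq≡q
        (λ e e≢p e≢q → join-off e≢p e≢q)

module Gluing {r ℓ} (R : CommutativeRing r ℓ) {n k : ℕ} (F : BoolFun R k) where
  open CommutativeRing R renaming (Carrier to C)
  open import Relation.Binary.Reasoning.Setoid setoid
  open Sums R
  open Weights R
  open Gadget

  value-by-closing : ∀ {m} (K : Gadget n k m) (G : Network n k) (P : (Fin m → Bool) → C) →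
    (∀ {x x′} → x ≗ x′ → P x ≈ P x′) →
    (∀ α → weight (match G) α ≈ weight (match K) α * P (λ j → α at dangle K j)) →
    sumBits m (λ x → gadgetFun R F K x * P x) ≈ value R F G
  value-by-closing {m} K G P P-resp G≈K*P = begin
    sumBits m (λ x → sumAssign R n k (λ α → term α x) * P x)
      ≈⟨ sum-cong (sumBits-linear m) (λ x → sum-*ʳ (sumAssign-linear n k) (λ α → term α x) (P x)) ⟩
    sumBits m (λ x → sumAssign R n k (λ α → term α x * P x))
      ≈⟨ sumBits-commutes m (sumAssign R n k) (sumAssign-linear n k) (λ x α → term α x * P x) ⟩
    sumAssign R n k (λ α → sumBits m (λ x → term α x * P x))
      ≈⟨ sum-cong (sumAssign-linear n k) collapse ⟩
    sumAssign R n k (λ α → (1# * Fs α) * weight (match G) α) ∎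
    where
    Fs : Assignment → C
    Fs α = bigProd R n (λ v → F (α v))
    δ : Assignment → (Fin m → Bool) → C
    δ α x = bigProd R m (λ j → eqInd R (α at dangle K j) (x j))
    term : Assignment → (Fin m → Bool) → C
    term α x = (δ α x * Fs α) * weight (match K) α
    rearrange : ∀ a b c d → ((a * b) * c) * d ≈ (b * c) * (a * d)
    rearrange a b c d = begin
      ((a * b) * c) * d ≈⟨ *-congʳ (*-assoc _ _ _) ⟩
      (a * (b * c)) * d ≈⟨ *-congʳ (*-comm _ _) ⟩
      ((b * c) * a) * d ≈⟨ *-assoc _ _ _ ⟩
      (b * c) * (a * d) ∎
    collapse : ∀ α → sumBits m (λ x → term α x * P x) ≈ (1# * Fs α) * weight (match G) α
    collapse α = begin
      sumBits m (λ x → term α x * P x)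
        ≈⟨ sum-cong (sumBits-linear m) (λ x → rearrange (δ α x) (Fs α) (weight (match K) α) (P x)) ⟩
      sumBits m (λ x → (Fs α * weight (match K) α) * (δ α x * P x))
        ≈⟨ sum-*ˡ (sumBits-linear m) _ _ ⟩
      (Fs α * weight (match K) α) * sumBits m (λ x → δ α x * P x)
        ≈⟨ *-congˡ (sumBits-eqInd m (λ j → α at dangle K j) P P-resp) ⟩
      (Fs α * weight (match K) α) * P (λ j → α at dangle K j)
        ≈⟨ *-assoc _ _ _ ⟩
      Fs α * (weight (match K) α * P (λ j → α at dangle K j))
        ≈⟨ *-cong (sym (*-identityˡ _)) (sym (G≈K*P α)) ⟩
      (1# * Fs α) * weight (match G) α ∎

sum-mono-≤ : ∀ {m} {f g : Fin m → ℕ} → (∀ i → f i ≤ g i) → sum f ≤ sum g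
sum-mono-≤ {zero}  _   = z≤n
sum-mono-≤ {suc m} f≤g = +-mono-≤ (f≤g Fin.zero) (sum-mono-≤ (f≤g ∘ Fin.suc))

sum-mono-< : ∀ {m} {f g : Fin m → ℕ} i₀ → (∀ i → f i ≤ g i) → f i₀ < g i₀ → sum f < sum g
sum-mono-< Fin.zero     f≤g f<g = +-mono-<-≤ f<g (sum-mono-≤ (f≤g ∘ Fin.suc))
sum-mono-< (Fin.suc i₀) f≤g f<g = +-mono-≤-< (f≤g Fin.zero) (sum-mono-< i₀ (f≤g ∘ Fin.suc) f<g)

failure : ∀ {A : Set} → Dec A → ℕ
failure (yes _) = 0
failure (no _)  = 1

failure-mono : ∀ {A B : Set} (a? : Dec A) (b? : Dec B) → (A → B) → failure b? ≤ failure a?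
failure-mono (yes a) (yes _) _   = z≤n
failure-mono (yes a) (no ¬b) A→B = ⊥-elim (¬b (A→B a))
failure-mono (no _)  (yes _) _   = z≤n
failure-mono (no _)  (no _)  _   = s≤s z≤n

failure-< : ∀ {A B : Set} (a? : Dec A) (b? : Dec B) → ¬ A → B → failure b? < failure a?
failure-< (yes a) _       ¬a _ = ⊥-elim (¬a a)
failure-< (no _)  (yes _) _  _ = s≤s z≤n
failure-< (no _)  (no ¬b) _  b = ⊥-elim (¬b b)

module _ {n k : ℕ} where

  mismatches : (M N : End n k → End n k) → ℕ
  mismatches M N = sum (λ v → sum (λ i → failure (M (v , i) ≟ᴱ N (v , i))))

  mismatches-< : ∀ {M M′ N : End n k → End n k} {e₀} → (∀ e → M e ≡ N e → M′ e ≡ N e) →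
    M′ e₀ ≡ N e₀ → M e₀ ≢ N e₀ → mismatches M′ N < mismatches M N
  mismatches-< {M} {M′} {N} {v₀ , i₀} keeps fixed differs =
    sum-mono-< v₀ (λ v → sum-mono-≤ (λ i → step (v , i)))
      (sum-mono-< i₀ (λ i → step (v₀ , i))
        (failure-< (M (v₀ , i₀) ≟ᴱ N (v₀ , i₀)) (M′ (v₀ , i₀) ≟ᴱ N (v₀ , i₀)) differs fixed))
    where
    step : ∀ e → failure (M′ e ≟ᴱ N e) ≤ failure (M e ≟ᴱ N e)
    step e = failure-mono (M e ≟ᴱ N e) (M′ e ≟ᴱ N e) (keeps e)

  agree-or-differ : ∀ (M N : End n k → End n k) → (∀ e → M e ≡ N e) ⊎ ∃[ e ] M e ≢ N e
  agree-or-differ M N with any? (λ v → any? (λ i → ¬? (M (v , i) ≟ᴱ N (v , i))))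
  ... | yes (v , i , differs) = inj₂ ((v , i) , differs)
  ... | no ¬differs = inj₁ agree
    where
    agree : ∀ e → M e ≡ N e
    agree (v , i) with M (v , i) ≟ᴱ N (v , i)
    ... | yes eq = eq
    ... | no differs = ⊥-elim (¬differs (v , i , differs))

fresh∷-injective : ∀ {A : Set} {m} {x : A} {xs : Fin m → A} →
  (∀ i → xs i ≢ x) → Injective _≡_ _≡_ xs → Injective _≡_ _≡_ (x ∷ xs)
fresh∷-injective _   _      {Fin.zero}  {Fin.zero}  _     = ≡.refl
fresh∷-injective x∉  _      {Fin.zero}  {Fin.suc j} x≡xsj = ⊥-elim (x∉ j (≡.sym x≡xsj))
fresh∷-injective x∉  _      {Fin.suc i} {Fin.zero}  xsi≡x = ⊥-elim (x∉ i xsi≡x)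
fresh∷-injective _   xs-inj {Fin.suc i} {Fin.suc j} eq    = ≡.cong Fin.suc (xs-inj eq)

network-no-fixed-point : ∀ {n k} (G : Network n k) e → Gadget.match G e ≢ e
network-no-fixed-point G e fixed with Gadget.fixed⇒dangling G e fixed
... | () , _

module Switching {r ℓ} (R : CommutativeRing r ℓ) (R-field : IsCharZeroField R) {n k : ℕ}
  (F : BoolFun R k) (arity4 : Arity4Cond R F)
  (G H : Network n k) (a : End n k) (a-differs : Gadget.match G a ≢ Gadget.match H a) where

  open CommutativeRing R renaming (Carrier to C)
  open import Relation.Binary.Reasoning.Setoid setoid
  open Sums R
  open Weights R
  open Gluing R {n} F
  open Matchings (_≟ᴱ_ {n} {k})
  open Gadget

  M : End n k → End n k
  M = match G

  b c d : End n k
  b = M a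
  c = match H a
  d = M c

  a≢b : a ≢ b
  a≢b = network-no-fixed-point G a ∘ ≡.sym
  a≢c : a ≢ c
  a≢c = network-no-fixed-point H a ∘ ≡.sym
  a≢d : a ≢ d
  a≢d a≡d = a-differs (≡.trans (≡.cong M a≡d) (involutive G c))
  b≢c : b ≢ c
  b≢c = a-differs
  b≢d : b ≢ d
  b≢d b≡d = a≢c (≡.trans (≡.sym (involutive G a)) (≡.trans (≡.cong M b≡d) (involutive G c)))
  c≢d : c ≢ d
  c≢d = network-no-fixed-point G c ∘ ≡.sym

  M₁ K : End n k → End n k
  M₁ = cutEdge c M
  K = cutEdge a M₁

  M₁a≡b : M₁ a ≡ b
  M₁a≡b = cutEdge-off a≢c a≢d

  a≢M₁a : a ≢ M₁ a
  a≢M₁a = ≡.subst (a ≢_) (≡.sym M₁a≡b) a≢b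

  M₁-involutive : Involutive _≡_ M₁
  M₁-involutive = cutEdge-involutive (involutive G)

  K-involutive : Involutive _≡_ K
  K-involutive = cutEdge-involutive M₁-involutive

  K-off : ∀ {e} → e ≢ a → e ≢ b → K e ≡ M₁ e
  K-off e≢a e≢b = cutEdge-off e≢a (λ e≡M₁a → e≢b (≡.trans e≡M₁a M₁a≡b))

  ends : Fin 4 → End n k
  ends = a ∷ b ∷ c ∷ d ∷ []

  ends-injective : Injective _≡_ _≡_ ends
  ends-injective =
    fresh∷-injective {xs = b ∷ c ∷ d ∷ []} (λ { 0F → a≢b ∘ ≡.sym ; 1F → a≢c ∘ ≡.sym ; 2F → a≢d ∘ ≡.sym }) (
    fresh∷-injective {xs = c ∷ d ∷ []} (λ { 0F → b≢c ∘ ≡.sym ; 1F → b≢d ∘ ≡.sym }) (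
    fresh∷-injective {xs = d ∷ []} (λ { 0F → c≢d ∘ ≡.sym }) (
    fresh∷-injective {xs = []} (λ ()) (λ { {()} }))))

  K-fixes-ends : ∀ j → K (ends j) ≡ ends j
  K-fixes-ends 0F = cutEdge-fixes-p {a} {M₁}
  K-fixes-ends 1F = ≡.subst (λ t → K t ≡ t) M₁a≡b (cutEdge-fixes-Mp {a} {M₁})
  K-fixes-ends 2F = ≡.trans (K-off (a≢c ∘ ≡.sym) (b≢c ∘ ≡.sym)) (cutEdge-fixes-p {c} {M})
  K-fixes-ends 3F = ≡.trans (K-off (a≢d ∘ ≡.sym) (b≢d ∘ ≡.sym)) (cutEdge-fixes-Mp {c} {M})

  K-fixed : ∀ e → K e ≡ e → ∃[ j ] ends j ≡ e
  K-fixed e Ke≡e with cutEdge-fixed Ke≡e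
  ... | inj₁ e≡a = 0F , ≡.sym e≡a
  ... | inj₂ (inj₁ e≡M₁a) = 1F , ≡.sym (≡.trans e≡M₁a M₁a≡b)
  ... | inj₂ (inj₂ M₁e≡e) with cutEdge-fixed M₁e≡e
  ...   | inj₁ e≡c = 2F , ≡.sym e≡c
  ...   | inj₂ (inj₁ e≡d) = 3F , ≡.sym e≡d
  ...   | inj₂ (inj₂ Me≡e) = ⊥-elim (network-no-fixed-point G e Me≡e)

  cut : Gadget n k 4
  cut = record
    { match          = K
    ; dangle         = ends
    ; dangle-inj     = ends-injective
    ; involutive     = K-involutive
    ; fixed⇒dangling = K-fixed
    ; dangling⇒fixed = K-fixes-ends
    }

  J M′ : End n k → End n k
  J = join b d K
  M′ = join a c J

  J-fixes-a : J a ≡ a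
  J-fixes-a = ≡.trans (join-off a≢b a≢d) (K-fixes-ends 0F)

  J-fixes-c : J c ≡ c
  J-fixes-c = ≡.trans (join-off (b≢c ∘ ≡.sym) c≢d) (K-fixes-ends 2F)

  M′-involutive : Involutive _≡_ M′
  M′-involutive = join-involutive
    (join-involutive K-involutive (K-fixes-ends 1F) (K-fixes-ends 3F)) J-fixes-a J-fixes-c

  M′-no-fixed-point : ∀ e → M′ e ≢ e
  M′-no-fixed-point e M′e≡e with join-fixed {K = J} a≢c M′e≡e
  ... | e≢a , e≢c , Je≡e with join-fixed {K = K} b≢d Je≡e
  ... | e≢b , e≢d , Ke≡e with K-fixed e Ke≡e
  ... | 0F , a≡e = e≢a (≡.sym a≡e)
  ... | 1F , b≡e = e≢b (≡.sym b≡e)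
  ... | 2F , c≡e = e≢c (≡.sym c≡e)
  ... | 3F , d≡e = e≢d (≡.sym d≡e)

  switched : Network n k
  switched = record
    { match          = M′
    ; dangle         = λ ()
    ; dangle-inj     = λ { {()} }
    ; involutive     = M′-involutive
    ; fixed⇒dangling = λ e M′e≡e → ⊥-elim (M′-no-fixed-point e M′e≡e)
    ; dangling⇒fixed = λ ()
    }

  weight-G : ∀ α → weight M α ≈ weight K α * pairing 0F 1F 2F 3F (λ j → α at ends j)
  weight-G α = begin
    weight M α
      ≈⟨ weight-cutEdge {M = M} {p = c} α (involutive G) c≢d ⟩
    weight M₁ α * neq2 R (α at c) (α at d)
      ≈⟨ *-congʳ (weight-cutEdge {M = M₁} {p = a} α M₁-involutive a≢M₁a) ⟩
    (weight K α * neq2 R (α at a) (α at M₁ a)) * neq2 R (α at c) (α at d)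
      ≡⟨ ≡.cong (λ t → (weight K α * neq2 R (α at a) (α at t)) * neq2 R (α at c) (α at d)) M₁a≡b ⟩
    (weight K α * neq2 R (α at a) (α at b)) * neq2 R (α at c) (α at d)
      ≈⟨ *-assoc _ _ _ ⟩
    weight K α * pairing 0F 1F 2F 3F (λ j → α at ends j) ∎

  weight-switched : ∀ α → weight M′ α ≈ weight K α * pairing 0F 2F 1F 3F (λ j → α at ends j)
  weight-switched α = begin
    weight M′ α
      ≈⟨ weight-join α a≢c J-fixes-a J-fixes-c ⟩
    weight J α * neq2 R (α at a) (α at c)
      ≈⟨ *-congʳ (weight-join α b≢d (K-fixes-ends 1F) (K-fixes-ends 3F)) ⟩
    (weight K α * neq2 R (α at b) (α at d)) * neq2 R (α at a) (α at c)
      ≈⟨ *-assoc _ _ _ ⟩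
    weight K α * (neq2 R (α at b) (α at d) * neq2 R (α at a) (α at c))
      ≈⟨ *-congˡ (*-comm _ _) ⟩
    weight K α * pairing 0F 2F 1F 3F (λ j → α at ends j) ∎

  value-switched≈0 : value R F G ≈ 0# → value R F switched ≈ 0#
  value-switched≈0 G≈0 with arity4 n cut
  ... | λ′ , τ , cut≈ = begin
    value R F switched                 ≈⟨ value-as-count 0F 2F 1F 3F switched weight-switched ⟩
    λ′ * natC R (common-count 0F 2F 1F 3F) ≈⟨ *-congʳ λ′≈0 ⟩
    0# * natC R (common-count 0F 2F 1F 3F) ≈⟨ zeroˡ _ ⟩
    0#                                 ∎
    where
    u : Fin 4 → Fin 4
    u = τ ⟨$⟩ʳ_
    u-injective : Injective _≡_ _≡_ u
    u-injective = Injection.injective (↔⇒↣ τ)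
    common-count : Fin 4 → Fin 4 → Fin 4 → Fin 4 → ℕ
    common-count p₀ p₁ p₂ p₃ =
      count 4 (λ x → separates x (u 0F) (u 1F) (u 2F) (u 3F) ∧ separates x p₀ p₁ p₂ p₃)
    value-as-count : ∀ p₀ p₁ p₂ p₃ (N : Network n k) →
      (∀ α → weight (match N) α ≈ weight K α * pairing p₀ p₁ p₂ p₃ (λ j → α at ends j)) →
      value R F N ≈ λ′ * natC R (common-count p₀ p₁ p₂ p₃)
    value-as-count p₀ p₁ p₂ p₃ N N≈K*pairing = begin
      value R F N
        ≈⟨ value-by-closing cut N (pairing p₀ p₁ p₂ p₃) (pairing-resp-≗ p₀ p₁ p₂ p₃) N≈K*pairing ⟨
      sumBits 4 (λ x → gadgetFun R F cut x * pairing p₀ p₁ p₂ p₃ x)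
        ≈⟨ sumBits-scaled-indicators 4 _ _ λ′ _ _
             (λ x → trans (cut≈ x) (*-congˡ (pairing-indicator (u 0F) (u 1F) (u 2F) (u 3F) x)))
             (pairing-indicator p₀ p₁ p₂ p₃) ⟩
      λ′ * natC R (common-count p₀ p₁ p₂ p₃) ∎
    λ′≈0 : λ′ ≈ 0#
    λ′≈0 = *-natC-cancel R-field λ′ (common-count 0F 1F 2F 3F)
      (count-common-separators≢0 (u 0F) (u 1F) (u 2F) (u 3F)
        ((λ ()) ∘ u-injective) ((λ ()) ∘ u-injective) ((λ ()) ∘ u-injective)
        ((λ ()) ∘ u-injective) ((λ ()) ∘ u-injective) ((λ ()) ∘ u-injective))
      (trans (sym (value-as-count 0F 1F 2F 3F G weight-G)) G≈0)

  switched-a : match switched a ≡ match H a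
  switched-a = join-p {a} {c} {J}

  switched-agrees : ∀ e → M e ≡ match H e → match switched e ≡ match H e
  switched-agrees e Me≡He = by-cases (e ≟ᴱ a) (e ≟ᴱ c) (e ≟ᴱ b) (e ≟ᴱ d)
    where
    Hm = match H
    by-cases : Dec (e ≡ a) → Dec (e ≡ c) → Dec (e ≡ b) → Dec (e ≡ d) → M′ e ≡ Hm e
    by-cases (yes ≡.refl) _ _ _ = ⊥-elim (a-differs Me≡He)
    by-cases (no _) (yes ≡.refl) _ _ = ≡.trans (join-q {a} {c} {J}) (≡.sym (involutive H a))
    by-cases (no _) (no _) (yes ≡.refl) _ = ⊥-elim (a-differs (≡.sym Ha≡b))
      where
      Ha≡b : Hm a ≡ b
      Ha≡b = ≡.trans (≡.cong Hm (≡.trans (≡.sym (involutive G a)) Me≡He)) (involutive H b)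
    by-cases (no _) (no _) (no _) (yes ≡.refl) = ⊥-elim (a≢d (≡.sym d≡a))
      where
      d≡a : d ≡ a
      d≡a = ≡.trans (≡.sym (involutive H d))
              (≡.trans (≡.cong Hm (≡.trans (≡.sym Me≡He) (involutive G c))) (involutive H a))
    by-cases (no e≢a) (no e≢c) (no e≢b) (no e≢d) =
      ≡.trans (join-off e≢a e≢c) (≡.trans (join-off e≢b e≢d)
        (≡.trans (K-off e≢a e≢b) (≡.trans (cutEdge-off e≢c e≢d) Me≡He)))

module Propagation {r ℓ} (R : CommutativeRing r ℓ) (R-field : IsCharZeroField R) {n k : ℕ}
  (F : BoolFun R k) (arity4 : Arity4Cond R F) (H : Network n k) where

  open CommutativeRing R
  open Sums R
  open Weights R
  open Gadget

  _⊏_ : Network n k → Network n k → Set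
  G′ ⊏ G = mismatches (match G′) (match H) < mismatches (match G) (match H)

  ⊏-wellFounded : WellFounded _⊏_
  ⊏-wellFounded = On.wellFounded (λ G → mismatches (match G) (match H)) <-wellFounded

  value-cong : ∀ G G′ → (∀ e → match G e ≡ match G′ e) → value R F G ≈ value R F G′
  value-cong G G′ G≗G′ = sum-cong (sumAssign-linear n k) (λ α → *-congˡ (weight-cong G≗G′ α))

  zero-propagates : ∀ G → Acc _⊏_ G → value R F G ≈ 0# → value R F H ≈ 0#
  zero-propagates G (acc rs) G≈0 with agree-or-differ (match G) (match H)
  ... | inj₁ G≗H = trans (sym (value-cong G H G≗H)) G≈0
  ... | inj₂ (a , a-differs) =
    zero-propagates switched (rs (mismatches-< switched-agrees switched-a a-differs))
      (value-switched≈0 G≈0)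
    where open Switching R R-field F arity4 G H a a-differs

mainTheorem10 : ∀ {c ℓ} (R : CommutativeRing c ℓ) → IsCharZeroField R →
    ∀ (k : ℕ) (F : BoolFun R k) → Arity2Cond R F → Arity4Cond R F →
    ∀ (n : ℕ) → n ≥ 1 → (G H : Network n k) →
    CommutativeRing._≈_ R (value R F G) (CommutativeRing.0# R) →
    CommutativeRing._≈_ R (value R F H) (CommutativeRing.0# R)
mainTheorem10 R R-field k F _ arity4 n _ G H G≈0 = zero-propagates G (⊏-wellFounded G) G≈0
  where open Propagation R R-field {n} F arity4 H
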